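{- If $n\ge 3$ is odd, then $\beta(F_n)=\beta(Q_n)$.
   Context: $Q_n$ is the hypercube with vertex set $\{0,1\}^n$, vertices adjacent iff they differ in exactly one coordinate; for $u\in\{0,1\}^n$, $\overline{u}=u+(1,\dots,1)\pmod 2$. The folded hypercube $F_n$ has vertex set $\{\{u,\overline{u}\}:u\in\{0,1\}^n\}$, with $\{u,\overline u\}$ adjacent to $\{v,\overline v\}$ iff $uv$ or $u\overline v$ is an edge of $Q_n$; equivalently $d_{F_n}(\{u,\overline u\},\{v,\overline v\})=\min\{d_{Q_n}(u,v),n-d_{Q_n}(u,v)\}$. For a graph $G$, a set $S\subseteq V(G)$ is resolving if for all distinct $u,v$ some $y\in S$ has $d_G(u,y)\neq d_G(v,y)$, and $\beta(G)$ is the minimum size of a resolving set. -}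

module Defs where

open import Data.Bool using (Bool; true; false; not)
open import Data.Nat using (ℕ; zero; suc; _+_; _∸_; _≤_; _⊓_)
open import Data.Fin using (Fin)
open import Data.Vec using (Vec; []; _∷_; map)
open import Data.Product using (Σ; ∃; _×_)
open import Data.Sum using (_⊎_)
open import Relation.Binary.PropositionalEquality using (_≡_; _≢_)
open import Relation.Nullary using (¬_)

Word : ℕ → Set
Word n = Vec Bool n

compl : ∀ {n} → Word n → Word n
compl = map not

ham : ∀ {n} → Word n → Word n → ℕ
ham [] [] = 0
ham (x ∷ xs) (y ∷ ys) with x Data.Bool.≟ y
... | Relation.Nullary.yes _ = ham xs ys
... | Relation.Nullary.no _ = suc (ham xs ys)

dQ : ∀ {n} → Word n → Word n → ℕ
dQ = ham

-- d_{F_n}({u,ū},{v,v̄}) = min(d_Q(u,v), n − d_Q(u,v)), on representatives.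
dF : ∀ n → Word n → Word n → ℕ
dF n u v = dQ u v ⊓ (n ∸ dQ u v)

-- Vertex equality: in Q_n literal equality; in F_n, u and ū represent the same vertex.
sameQ : ∀ {n} → Word n → Word n → Set
sameQ u v = u ≡ v

sameF : ∀ {n} → Word n → Word n → Set
sameF u v = (u ≡ v) ⊎ (u ≡ compl v)

Resolving : {V : Set} → (V → V → Set) → (V → V → ℕ) → ∀ {k} → (Fin k → V) → Set
Resolving {V} _≈_ d {k} S =
  (u v : V) → ¬ (u ≈ v) → Σ (Fin k) (λ i → d u (S i) ≢ d v (S i))

IsMetricDim : {V : Set} → (V → V → Set) → (V → V → ℕ) → ℕ → Set
IsMetricDim {V} _≈_ d k =
  Σ (Fin k → V) (λ S → Resolving _≈_ d S) ×
  ((m : ℕ) (S : Fin m → V) → Resolving _≈_ d S → k ≤ m)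

{-# OPTIONS --safe #-}
module Submission where

-- For odd n the map a ↦ a ⊓ (n ∸ a) is injective on numbers of equal parity, because
-- a + c = n is impossible when a and c have the same parity. If u and w have Hamming
-- weights of the same parity, then d(u,s) and d(w,s) have the same parity for every
-- landmark s, so d_F(u,s) = d_F(w,s) forces d(u,s) = d(w,s). Exactly one of v, v̄ has
-- the weight parity of u, and a landmark separating u from it in Q_n separates {u,ū}
-- from {v,v̄} in F_n. Conversely, landmarks of F_n separate the non-antipodal pairs of
-- Q_n, and every landmark separates u from ū since d(u,s) + d(ū,s) = n is odd. So Q_n
-- and F_n have the same resolving sets, and a smallest one exists because
-- resolvability is decidable on a finite graph.

open import Defs
open import Data.Nat using (ℕ; _≤_; _%_)
open import Data.Product using (∃; _×_)
open import Relation.Binary.PropositionalEquality using (_≡_)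

open import Data.Bool using (Bool; true; false; not; _xor_)
import Data.Bool as Bool
open import Data.Bool.Properties
  using (not-involutive; not-distribˡ-xor; not-distribʳ-xor; xor-same; ¬-not)
open import Data.Empty using (⊥-elim)
open import Data.Fin using (Fin)
open import Data.Fin.Properties using (any?)
open import Data.Fin.Subset.Properties using (anySubset?)
open import Data.List using (List; _++_)
import Data.List as List
open import Data.List.Membership.Propositional using (_∈_)
open import Data.List.Membership.Propositional.Properties using (∈-map⁺; ∈-++⁺ˡ; ∈-++⁺ʳ)
open import Data.List.Relation.Unary.Any using (here; index)
open import Data.List.Relation.Unary.Any.Properties using (lookup-index)
open import Data.Nat using (zero; suc; _+_; _∸_; _⊓_; _<_; s≤s)
open import Data.Nat.Properties
  using (_≟_; ≤-refl; +-suc; ≮⇒≥; m<1+n⇒m<n∨m≡n; ⊓-sel; ⊓-comm; m≤n+m; m+n∸n≡m;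
         m∸n+n≡m; m+[n∸m]≡n; m∸[m∸n]≡n; ∸-cancelˡ-≡)
open import Data.Product using (_,_; proj₁)
import Data.Product as Product
open import Data.Sum using (_⊎_; inj₁; inj₂; [_,_])
open import Data.Vec using (Vec; []; _∷_; lookup; tabulate; replicate)
open import Data.Vec.Properties using (≡-dec; lookup∘tabulate)
open import Function using (_∘_)
open import Level using (0ℓ)
open import Relation.Binary.Definitions using () renaming (Decidable to Decidable₂)
open import Relation.Binary.PropositionalEquality
  using (_≢_; refl; sym; trans; cong; subst; module ≡-Reasoning)
open import Relation.Nullary using (¬_; Dec; yes; no; ¬?; _→-dec_; contradiction)
open import Relation.Nullary.Decidable using (map′; decidable-stable)
open import Relation.Unary using (Pred; Decidable)

private
  variable
    n m k : ℕ
    A V : Set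

Least : Pred ℕ 0ℓ → ℕ → Set
Least P k = P k × (∀ m → P m → k ≤ m)

module _ {P : Pred ℕ 0ℓ} (P? : Decidable P) where

  private
    leastBelow : ∀ N → (∃ (Least P)) ⊎ (∀ m → m < N → ¬ P m)
    leastBelow zero = inj₂ (λ _ ())
    leastBelow (suc N) with leastBelow N | P? N
    ... | inj₁ least | _     = inj₁ least
    ... | inj₂ none  | yes p = inj₁ (N , p , λ m pm → ≮⇒≥ (λ m<N → none m m<N pm))
    ... | inj₂ none  | no ¬p =
      inj₂ λ m m<1+N → [ none m , (λ { refl → ¬p }) ] (m<1+n⇒m<n∨m≡n m<1+N)

  least : P k → ∃ (Least P)
  least {k} pk with leastBelow (suc k)
  ... | inj₁ least = least
  ... | inj₂ none  = ⊥-elim (none k ≤-refl pk)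

Exhaustible : Set → Set₁
Exhaustible A = ∀ {P : Pred A 0ℓ} → Decidable P → Dec (∃ P)

∀? : Exhaustible A → {P : Pred A 0ℓ} → Decidable P → Dec (∀ a → P a)
∀? ex P? = map′
  (λ ¬∃¬P a → decidable-stable (P? a) (λ ¬Pa → ¬∃¬P (a , ¬Pa)))
  (λ ∀P (a , ¬Pa) → ¬Pa (∀P a))
  (¬? (ex (¬? ∘ P?)))

exhaustible-Vec : Exhaustible A → ∀ m → Exhaustible (Vec A m)
exhaustible-Vec ex zero    P? = map′ ([] ,_) (λ { ([] , p) → p }) (P? [])
exhaustible-Vec ex (suc m) P? = map′
  (λ (a , as , p) → a ∷ as , p)
  (λ { (a ∷ as , p) → a , as , p })
  (ex λ a → exhaustible-Vec ex m (P? ∘ (a ∷_)))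

module _ (_≈_ : V → V → Set) (d : V → V → ℕ) where

  resolving-cong : {S T : Fin m → V} → (∀ i → S i ≡ T i) →
                   Resolving _≈_ d S → Resolving _≈_ d T
  resolving-cong S≗T res u v u≉v =
    Product.map₂ (λ {i} → subst (λ x → d u x ≢ d v x) (S≗T i)) (res u v u≉v)

  surjective⇒resolving : (∀ v → d v v ≡ 0) → (∀ u v → d u v ≡ 0 → u ≈ v) →
                         {S : Fin m → V} → (∀ v → ∃ λ i → S i ≡ v) → Resolving _≈_ d S
  surjective⇒resolving d-self d≡0⇒≈ {S} surj u v u≉v with surj v
  ... | i , refl = i , λ eq → u≉v (d≡0⇒≈ u (S i) (trans eq (d-self (S i))))

  module _ (ex : Exhaustible V) (≈? : Decidable₂ _≈_) where

    resolving? : (S : Fin m → V) → Dec (Resolving _≈_ d S)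
    resolving? S = ∀? ex λ u → ∀? ex λ v →
      ¬? (≈? u v) →-dec any? (λ i → ¬? (d u (S i) ≟ d v (S i)))

    resolvingOfSize? : Decidable (λ m → ∃ λ (S : Fin m → V) → Resolving _≈_ d S)
    resolvingOfSize? m = map′
      (λ (vs , res) → lookup vs , res)
      (λ (S , res) → tabulate S , resolving-cong (sym ∘ lookup∘tabulate S) res)
      (exhaustible-Vec ex m (resolving? ∘ lookup))

    isMetricDim-exists : (S : Fin m → V) → Resolving _≈_ d S → ∃ (IsMetricDim _≈_ d)
    isMetricDim-exists S res with least resolvingOfSize? (S , res)
    ... | k , witness , minimal = k , witness , λ m T resT → minimal m (T , resT)

isMetricDim-transfer :
  {_≈₁_ _≈₂_ : V → V → Set} {d₁ d₂ : V → V → ℕ} →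
  (∀ {m} (S : Fin m → V) → Resolving _≈₁_ d₁ S → Resolving _≈₂_ d₂ S) →
  (∀ {m} (S : Fin m → V) → Resolving _≈₂_ d₂ S → Resolving _≈₁_ d₁ S) →
  IsMetricDim _≈₁_ d₁ k → IsMetricDim _≈₂_ d₂ k
isMetricDim-transfer 1⇒2 2⇒1 ((S , res) , minimal) =
  (S , 1⇒2 S res) , λ m T resT → minimal m T (2⇒1 T resT)

parity : ℕ → Bool
parity zero    = false
parity (suc n) = not (parity n)

parity-+ : ∀ m n → parity (m + n) ≡ parity m xor parity n
parity-+ zero    n = refl
parity-+ (suc m) n = trans (cong not (parity-+ m n)) (not-distribˡ-xor (parity m) (parity n))

parity-odd : ∀ n → n % 2 ≡ 1 → parity n ≡ true
parity-odd zero          ()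
parity-odd (suc zero)    _ = refl
parity-odd (suc (suc n)) h = cong (not ∘ not) (parity-odd n h)

sameParity⇒+≢odd : ∀ a c → parity n ≡ true → parity a ≡ parity c → a + c ≢ n
sameParity⇒+≢odd {n} a c odd same a+c≡n = contradiction (trans (sym odd) even) λ ()
  where
  open ≡-Reasoning
  even : parity n ≡ false
  even = begin
    parity n              ≡⟨ cong parity a+c≡n ⟨
    parity (a + c)        ≡⟨ parity-+ a c ⟩
    parity a xor parity c ≡⟨ cong (_xor parity c) same ⟩
    parity c xor parity c ≡⟨ xor-same (parity c) ⟩
    false                 ∎

⊓∸-injective : ∀ {a c} → parity n ≡ true → a ≤ n → c ≤ n → parity a ≡ parity c →
               a ⊓ (n ∸ a) ≡ c ⊓ (n ∸ c) → a ≡ c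
⊓∸-injective {n} {a} {c} odd a≤n c≤n same eq with ⊓-sel a (n ∸ a) | ⊓-sel c (n ∸ c)
... | inj₁ p | inj₁ q = trans (sym p) (trans eq q)
... | inj₁ p | inj₂ q = ⊥-elim (sameParity⇒+≢odd a c odd same
  (trans (cong (_+ c) (trans (sym p) (trans eq q))) (m∸n+n≡m c≤n)))
... | inj₂ p | inj₁ q = ⊥-elim (sameParity⇒+≢odd a c odd same
  (trans (cong (a +_) (trans (sym q) (trans (sym eq) p))) (m+[n∸m]≡n a≤n)))
... | inj₂ p | inj₂ q = ∸-cancelˡ-≡ a≤n c≤n (trans (sym p) (trans eq q))

weightParity : Word n → Bool
weightParity []      = false
weightParity (x ∷ u) = x xor weightParity u

ham-self : (u : Word n) → ham u u ≡ 0
ham-self []          = refl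
ham-self (true ∷ u)  = ham-self u
ham-self (false ∷ u) = ham-self u

ham≡0⇒≡ : (u v : Word n) → ham u v ≡ 0 → u ≡ v
ham≡0⇒≡ []          []          _ = refl
ham≡0⇒≡ (true ∷ u)  (true ∷ v)  h = cong (true ∷_) (ham≡0⇒≡ u v h)
ham≡0⇒≡ (false ∷ u) (false ∷ v) h = cong (false ∷_) (ham≡0⇒≡ u v h)
ham≡0⇒≡ (true ∷ u)  (false ∷ v) ()
ham≡0⇒≡ (false ∷ u) (true ∷ v)  ()

ham-compl : (u v : Word n) → ham (compl u) v + ham u v ≡ n
ham-compl []          []          = refl
ham-compl (true ∷ u)  (true ∷ v)  = cong suc (ham-compl u v)
ham-compl (false ∷ u) (false ∷ v) = cong suc (ham-compl u v)
ham-compl (true ∷ u)  (false ∷ v) = trans (+-suc _ _) (cong suc (ham-compl u v))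
ham-compl (false ∷ u) (true ∷ v)  = trans (+-suc _ _) (cong suc (ham-compl u v))

ham-compl-∸ : (u v : Word n) → ham (compl u) v ≡ n ∸ ham u v
ham-compl-∸ u v =
  trans (sym (m+n∸n≡m (ham (compl u) v) (ham u v))) (cong (_∸ ham u v) (ham-compl u v))

ham≤n : (u v : Word n) → ham u v ≤ n
ham≤n u v = subst (ham u v ≤_) (ham-compl u v) (m≤n+m (ham u v) (ham (compl u) v))

parity-ham : (u v : Word n) → parity (ham u v) ≡ weightParity u xor weightParity v
parity-ham []          []          = refl
parity-ham (false ∷ u) (false ∷ v) = parity-ham u v
parity-ham (true ∷ u)  (false ∷ v) =
  trans (cong not (parity-ham u v)) (not-distribˡ-xor (weightParity u) (weightParity v))
parity-ham (false ∷ u) (true ∷ v)  =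
  trans (cong not (parity-ham u v)) (not-distribʳ-xor (weightParity u) (weightParity v))
parity-ham (true ∷ u)  (true ∷ v)  =
  trans (parity-ham u v) (xor-not-not (weightParity u) (weightParity v))
  where
  open ≡-Reasoning
  xor-not-not : ∀ a b → a xor b ≡ not a xor not b
  xor-not-not a b = begin
    a xor b             ≡⟨ not-involutive (a xor b) ⟨
    not (not (a xor b)) ≡⟨ cong not (not-distribʳ-xor a b) ⟩
    not (a xor not b)   ≡⟨ not-distribˡ-xor a (not b) ⟩
    not a xor not b     ∎

sameWeightParity⇒sameParity-ham : (u w : Word n) → weightParity u ≡ weightParity w →
                                  (s : Word n) → parity (ham u s) ≡ parity (ham w s)
sameWeightParity⇒sameParity-ham u w same s = begin
  parity (ham u s)                  ≡⟨ parity-ham u s ⟩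
  weightParity u xor weightParity s ≡⟨ cong (_xor weightParity s) same ⟩
  weightParity w xor weightParity s ≡⟨ parity-ham w s ⟨
  parity (ham w s)                  ∎
  where open ≡-Reasoning

weightParity-compl : parity n ≡ true → (v : Word n) →
                     weightParity (compl v) ≡ not (weightParity v)
weightParity-compl {n} odd v = xor≡true⇒≡not (begin
  weightParity (compl v) xor weightParity v ≡⟨ parity-ham (compl v) v ⟨
  parity (ham (compl v) v)                  ≡⟨ cong parity (ham-compl-∸ v v) ⟩
  parity (n ∸ ham v v)                      ≡⟨ cong (parity ∘ (n ∸_)) (ham-self v) ⟩
  parity n                                  ≡⟨ odd ⟩
  true                                      ∎)
  where
  open ≡-Reasoning
  xor≡true⇒≡not : ∀ {x y} → x xor y ≡ true → x ≡ not y
  xor≡true⇒≡not {true}  {true}  ()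
  xor≡true⇒≡not {true}  {false} _ = refl
  xor≡true⇒≡not {false} {true}  _ = refl
  xor≡true⇒≡not {false} {false} ()

sameF-representative : parity n ≡ true → (u v : Word n) →
                       ∃ λ w → sameF w v × (∀ s → parity (ham u s) ≡ parity (ham w s))
sameF-representative odd u v with weightParity u Bool.≟ weightParity v
... | yes same = v , inj₁ refl , sameWeightParity⇒sameParity-ham u v same
... | no differ = compl v , inj₂ refl , sameWeightParity⇒sameParity-ham u (compl v)
  (trans (¬-not differ) (sym (weightParity-compl odd v)))

dF-resp-sameF : {w v : Word n} → sameF w v → (s : Word n) → dF n w s ≡ dF n v s
dF-resp-sameF (inj₁ refl) s = refl
dF-resp-sameF {n} {v = v} (inj₂ refl) s = begin
  ham (compl v) s ⊓ (n ∸ ham (compl v) s) ≡⟨ cong (λ h → h ⊓ (n ∸ h)) (ham-compl-∸ v s) ⟩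
  (n ∸ ham v s) ⊓ (n ∸ (n ∸ ham v s))     ≡⟨ cong ((n ∸ ham v s) ⊓_) (m∸[m∸n]≡n (ham≤n v s)) ⟩
  (n ∸ ham v s) ⊓ ham v s                 ≡⟨ ⊓-comm (n ∸ ham v s) (ham v s) ⟩
  ham v s ⊓ (n ∸ ham v s)                 ∎
  where open ≡-Reasoning

Q⇒F-resolving : parity n ≡ true → {S : Fin m → Word n} →
                Resolving (sameQ {n}) dQ S → Resolving sameF (dF n) S
Q⇒F-resolving odd {S} resQ u v u≉v with sameF-representative odd u v
... | w , w≈v , same with resQ u w (λ { refl → u≉v w≈v })
...   | i , separates = i , λ eq → separates (⊓∸-injective odd (ham≤n u (S i)) (ham≤n w (S i))
          (same (S i)) (trans eq (sym (dF-resp-sameF w≈v (S i)))))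

F⇒Q-resolving : parity (2 + n) ≡ true → {S : Fin m → Word (2 + n)} →
                Resolving sameF (dF (2 + n)) S → Resolving (sameQ {2 + n}) dQ S
F⇒Q-resolving {n} {m} odd {S} resF u v u≢v with ≡-dec Bool._≟_ u (compl v)
... | yes refl =
  i , λ eq → sameParity⇒+≢odd (ham (compl v) (S i)) (ham v (S i)) odd
                (cong parity eq) (ham-compl v (S i))
  where
  -- any landmark separates v̄ from v; one exists because F_{2+n} has two distinct vertices
  i : Fin m
  i = proj₁ (resF (replicate _ false) (true ∷ replicate _ false) λ { (inj₁ ()) ; (inj₂ ()) })
... | no u≢v̄ with resF u v [ u≢v , u≢v̄ ]
...   | i , separates = i , separates ∘ cong (λ h → h ⊓ (2 + n ∸ h))

-- Subset n is Vec Bool n as well.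
exhaustible-Word : Exhaustible (Word n)
exhaustible-Word = anySubset?

words : ∀ n → List (Word n)
words zero    = List.[ [] ]
words (suc n) = List.map (true ∷_) (words n) ++ List.map (false ∷_) (words n)

∈-words : (w : Word n) → w ∈ words n
∈-words []          = here refl
∈-words (true ∷ w)  = ∈-++⁺ˡ (∈-map⁺ (true ∷_) (∈-words w))
∈-words {suc n} (false ∷ w) =
  ∈-++⁺ʳ (List.map (true ∷_) (words n)) (∈-map⁺ (false ∷_) (∈-words w))

words-resolving : Resolving (sameQ {n}) dQ (List.lookup (words n))
words-resolving = surjective⇒resolving sameQ dQ ham-self ham≡0⇒≡
  λ v → index (∈-words v) , sym (lookup-index (∈-words v))

lemma6 : (n : ℕ) → 3 ≤ n → n % 2 ≡ 1 →
    ∃ λ k → IsMetricDim (sameQ {n}) (dQ {n}) k × IsMetricDim (sameF {n}) (dF n) k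
lemma6 n@(suc (suc _)) (s≤s (s≤s _)) n%2≡1
  with isMetricDim-exists sameQ dQ exhaustible-Word (≡-dec Bool._≟_)
         (List.lookup (words n)) words-resolving
... | k , dimQ = k , dimQ , isMetricDim-transfer {_≈₁_ = sameQ} {sameF} {dQ} {dF n}
                                (λ _ → Q⇒F-resolving odd) (λ _ → F⇒Q-resolving odd) dimQ
  where
  odd : parity n ≡ true
  odd = parity-odd n n%2≡1
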